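{- Let $k\ge 2$ be an integer and $G$ a graph. Then $G$ is strictly $k$-colorable if and only if $G$ is $k$-colorable and $G$ is not $\{1*(k-2),2\}$-choosable.
   Context: Graphs are finite and simple. An integer partition $\lambda$ of a positive integer $k$ is a multiset of positive integers summing to $k$; $a*b$ denotes $b$ copies of $a$, so $\{1*(k-2),2\}$ consists of $k-2$ ones and one $2$. A $k$-assignment $L$ of $G$ assigns to each vertex $v$ a set $L(v)$ of $k$ colors; $G$ is $L$-colorable if there is a proper coloring with each vertex $v$ receiving a color from $L(v)$. For an integer partition $\lambda=\{k_1,\dots,k_t\}$ of $k$, a $\lambda$-assignment of $G$ is a $k$-assignment $L$ such that $\bigcup_{v}L(v)$ can be partitioned into sets $C_1,\dots,C_t$ with $|L(v)\cap C_i|=k_i$ for every vertex $v$ and every $i$. $G$ is $\lambda$-choosable if $G$ is $L$-colorable for every $\lambda$-assignment $L$. It is known (Zhu) that $G$ is $\{1*k\}$-choosable iff $G$ is $k$-colorable. A graph $G$ is strictly $k$-colorable if $\{1*k\}$ is the only integer partition $\lambda$ of $k$ for which $G$ is $\lambda$-choosable, i.e. $G$ is $\{1*k\}$-choosable and not $\lambda$-choosable for any other partition $\lambda$ of $k$. -}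

module Defs where

open import Data.Nat using (ℕ; zero; suc; _<_; _≤_)
open import Data.Fin using (Fin) renaming (_≟_ to _≟ᶠ_)
open import Data.List using (List; []; _∷_; length; filter; replicate; _++_; lookup)
open import Data.Nat.ListAction using (sum)
open import Data.List.Relation.Unary.All using (All)
open import Data.List.Relation.Unary.Unique.Propositional using (Unique)
open import Data.List.Membership.Propositional using (_∈_)
open import Data.List.Relation.Binary.Permutation.Propositional using (_↭_)
open import Data.Product using (Σ; _×_; _,_; ∃)
open import Relation.Binary.PropositionalEquality using (_≡_; _≢_)
open import Relation.Nullary using (¬_)

record Graph (n : ℕ) : Set₁ where
  field
    Adj    : Fin n → Fin n → Set
    sym    : ∀ {u v} → Adj u v → Adj v u
    irrefl : ∀ {v} → ¬ Adj v v
open Graph public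

Color : Set
Color = ℕ

-- An integer partition of k: a (multi)set of positive integers summing to k,
-- represented as a list (order irrelevant; multisets compared up to ↭).
IsPartition : ℕ → List ℕ → Set
IsPartition k λs = All (λ x → 0 < x) λs × sum λs ≡ k

Colorable : ∀ {n} → ℕ → Graph n → Set
Colorable {n} k G =
  Σ (Fin n → Fin k) λ f → ∀ u v → Adj G u v → f u ≢ f v

ListAssignment : ℕ → Set
ListAssignment n = Fin n → List Color

IsKAssignment : ∀ {n} → ℕ → ListAssignment n → Set
IsKAssignment k L = ∀ v → Unique (L v) × length (L v) ≡ k

-- L is a λ-assignment (λ a partition of k given as a list of length t):
-- L is a k-assignment and the colors can be partitioned into classes
-- C_1..C_t (given by a class map cls : Color → Fin t; colors outside the
-- union of the lists are irrelevant) with |L(v) ∩ C_i| = k_i.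
IsλAssignment : ∀ {n} → (λs : List ℕ) → ListAssignment n → Set
IsλAssignment λs L =
  IsKAssignment (sum λs) L ×
  Σ (Color → Fin (length λs)) λ cls →
    ∀ v i → length (filter (λ c → cls c ≟ᶠ i) (L v)) ≡ lookup λs i

LColorable : ∀ {n} → Graph n → ListAssignment n → Set
LColorable {n} G L =
  Σ (Fin n → Color) λ c → (∀ v → c v ∈ L v) × (∀ u v → Adj G u v → c u ≢ c v)

Choosable : ∀ {n} → List ℕ → Graph n → Set
Choosable {n} λs G = ∀ (L : ListAssignment n) → IsλAssignment λs L → LColorable G L

ones : ℕ → List ℕ
ones k = replicate k 1

StrictlyColorable : ∀ {n} → ℕ → Graph n → Set
StrictlyColorable {n} k G =
  Choosable (ones k) G ×
  (∀ (λs : List ℕ) → IsPartition k λs → Choosable λs G → λs ↭ ones k)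

-- If λ arises from μ by merging parts, every μ-assignment is a λ-assignment
-- (merge the corresponding colour classes), so λ-choosability implies
-- μ-choosability. A partition of k ≥ 2 other than {1*k} has a part ≥ 2 and so
-- arises from {1*(k-2), 2} by merging; hence if G is not {1*(k-2), 2}-choosable,
-- {1*k} is the only candidate left, and {1*k}-choosability is k-colourability
-- (Zhu). Conversely {1*(k-2), 2} is itself a partition other than {1*k}.
module Submission where

open import Defs
open import Data.Nat using (ℕ; _≤_; _∸_)
open import Data.List using (List; []; _∷_; _++_; replicate)
open import Data.Product using (_×_)
open import Relation.Nullary using (¬_)
open import Function.Bundles using (_⇔_)

open import Data.Nat using (zero; suc; _+_; _<_; z≤n; s≤s; NonZero; _≟_)
open import Data.Nat.Properties using (+-suc; +-assoc; +-comm; +-identityʳ; suc-injective)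
open import Data.Nat.DivMod using (_mod_; m<n⇒m%n≡m)
open import Data.Nat.ListAction using (sum)
open import Data.Nat.ListAction.Properties using (sum-↭; sum-++)
open import Data.Fin using (Fin; zero; suc; toℕ) renaming (_≟_ to _≟ᶠ_)
open import Data.Fin.Properties using (toℕ-injective; toℕ-fromℕ<; toℕ<n; 0≢1+n)
open import Data.Fin.Permutation using (_⟨$⟩ʳ_; _⟨$⟩ˡ_; inverseˡ; inverseʳ)
open import Data.List using (length; filter; lookup; map; allFin)
open import Data.List.Properties using (length-replicate; length-map; length-tabulate; filter-≐; filter-accept; filter-reject; filter-none; ++-assoc; ++-identityʳ)
open import Data.List.Relation.Unary.All as All using (All; []; _∷_)
open import Data.List.Relation.Unary.All.Properties using (replicate⁺; ++⁺)
open import Data.List.Relation.Unary.AllPairs using (_∷_)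
open import Data.List.Relation.Unary.Any using (here; there)
open import Data.List.Relation.Unary.Unique.Propositional using (Unique)
open import Data.List.Relation.Unary.Unique.Propositional.Properties using (map⁺; allFin⁺)
open import Data.List.Membership.Propositional using (_∈_)
open import Data.List.Membership.Propositional.Properties using (∈-map⁺; ∈-map⁻; ∈-allFin; ∈-lookup; ∈-++⁺ʳ)
open import Data.List.Relation.Binary.Permutation.Propositional using (_↭_; ↭-refl; ↭-prep; ↭-swap; ↭-sym; ↭-trans; ↭-reflexive; ↭⇒↭ₛ)
open import Data.List.Relation.Binary.Permutation.Propositional.Properties using (∈-resp-↭; ++-comm; ++⁺ʳ; shifts)
import Relation.Binary.PropositionalEquality as ≡
open import Data.List.Relation.Binary.Permutation.Setoid (≡.setoid ℕ) using (onIndices)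
open import Data.List.Relation.Binary.Permutation.Setoid.Properties (≡.setoid ℕ) using (onIndices-lookup)
open import Data.Product using (_,_; proj₁; proj₂; ∃₂; ∃-syntax)
import Data.Product as Product
open import Data.Sum using (_⊎_; inj₁; inj₂; [_,_])
open import Data.Empty using (⊥)
open import Relation.Nullary using (Dec; yes; no; contradiction)
open import Relation.Unary using (Pred; Decidable)
open import Relation.Unary.Properties using (_∪?_)
open import Relation.Binary.PropositionalEquality using (_≡_; _≢_; refl; trans; cong; cong₂; subst; subst₂; module ≡-Reasoning)
open import Function.Base using (_∘_; id; const)
open import Function.Bundles using (mk⇔; Equivalence)
open import Level using (0ℓ)

module _ {A : Set} {P Q : Pred A 0ℓ} (P? : Decidable P) (Q? : Decidable Q) where

  filter-≐-∈ : ∀ xs → (∀ {x} → x ∈ xs → P x → Q x) → (∀ {x} → x ∈ xs → Q x → P x) →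
               filter P? xs ≡ filter Q? xs
  filter-≐-∈ [] _ _ = refl
  filter-≐-∈ (x ∷ xs) P⇒Q Q⇒P with P? x | Q? x
  ... | yes _  | yes _  = cong (x ∷_) (filter-≐-∈ xs (P⇒Q ∘ there) (Q⇒P ∘ there))
  ... | yes px | no ¬qx = contradiction (P⇒Q (here refl) px) ¬qx
  ... | no ¬px | yes qx = contradiction (Q⇒P (here refl) qx) ¬px
  ... | no _   | no _   = filter-≐-∈ xs (P⇒Q ∘ there) (Q⇒P ∘ there)

  length-filter-∪ : (∀ {x} → P x → ¬ Q x) → ∀ xs →
                    length (filter (P? ∪? Q?) xs) ≡ length (filter P? xs) + length (filter Q? xs)
  length-filter-∪ _ [] = refl
  length-filter-∪ P⇒¬Q (x ∷ xs) with P? x | Q? x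
  ... | yes px | yes qx = contradiction qx (P⇒¬Q px)
  ... | yes _  | no _   = cong suc (length-filter-∪ P⇒¬Q xs)
  ... | no _   | yes _  = trans (cong suc (length-filter-∪ P⇒¬Q xs)) (≡.sym (+-suc _ _))
  ... | no _   | no _   = length-filter-∪ P⇒¬Q xs

filter-witness : ∀ {A : Set} {P : Pred A 0ℓ} (P? : Decidable P) {m} xs →
                 length (filter P? xs) ≡ suc m → ∃[ x ] x ∈ xs × P x
filter-witness P? (x ∷ xs) eq with P? x
... | yes px = x , here refl , px
... | no _   = Product.map₂ (Product.map₁ there) (filter-witness P? xs eq)

module _ {A : Set} (_≟_ : (x y : A) → Dec (x ≡ y)) where

  length-filter-≟-unique : ∀ {x xs} → Unique xs → x ∈ xs → length (filter (_≟ x) xs) ≡ 1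
  length-filter-≟-unique {x} {_ ∷ xs} (x∉xs ∷ _) (here refl) = begin
    length (filter (_≟ x) (x ∷ xs)) ≡⟨ cong length (filter-accept (_≟ x) refl) ⟩
    suc (length (filter (_≟ x) xs)) ≡⟨ cong (suc ∘ length) (filter-none (_≟ x) (All.map (_∘ ≡.sym) x∉xs)) ⟩
    1                               ∎
    where open ≡-Reasoning
  length-filter-≟-unique {x} (y∉ys ∷ u) (there x∈ys) =
    trans (cong length (filter-reject (_≟ x) (All.lookup y∉ys x∈ys))) (length-filter-≟-unique u x∈ys)

infix 4 _⊑_ _≼_

record _⊑_ (μ λs : List ℕ) : Set where
  constructor coarsening
  field coarsen : ∀ {n} (L : ListAssignment n) → IsλAssignment μ L → IsλAssignment λs L
open _⊑_

⊑-trans : ∀ {μ ν λs} → μ ⊑ ν → ν ⊑ λs → μ ⊑ λs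
⊑-trans μ⊑ν ν⊑λ = coarsening λ L → coarsen ν⊑λ L ∘ coarsen μ⊑ν L

choosable-⊑ : ∀ {n μ λs} {G : Graph n} → μ ⊑ λs → Choosable λs G → Choosable μ G
choosable-⊑ μ⊑λ ch L = ch L ∘ coarsen μ⊑λ L

ClassSizes : ∀ {n} (λs : List ℕ) → ListAssignment n → (Color → Fin (length λs)) → Set
ClassSizes λs L cls = ∀ v i → length (filter (λ c → cls c ≟ᶠ i) (L v)) ≡ lookup λs i

⊑-via : ∀ {μ λs} (h : Fin (length μ) → Fin (length λs)) → sum μ ≡ sum λs →
        (∀ {n} (L : ListAssignment n) cls → ClassSizes μ L cls → ClassSizes λs L (h ∘ cls)) →
        μ ⊑ λs
⊑-via h sum≡ classSizes = coarsening λ { L (sizes , cls , count) →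
  (λ v → Product.map₂ (λ e → trans e sum≡) (sizes v)) , h ∘ cls , classSizes L cls count }

↭⇒⊑ : ∀ {μ λs} → μ ↭ λs → μ ⊑ λs
↭⇒⊑ {μ} {λs} μ↭λ = ⊑-via (π ⟨$⟩ʳ_) (sum-↭ μ↭λ) λ L cls count v i → begin
    length (filter (λ c → π ⟨$⟩ʳ cls c ≟ᶠ i) (L v))
      ≡⟨ cong length (filter-≐ _ _ ((λ e → trans (≡.sym (inverseˡ π)) (cong (π ⟨$⟩ˡ_) e))
                                   , (λ e → trans (cong (π ⟨$⟩ʳ_) e) (inverseʳ π))) (L v)) ⟩
    length (filter (λ c → cls c ≟ᶠ π ⟨$⟩ˡ i) (L v)) ≡⟨ count v (π ⟨$⟩ˡ i) ⟩
    lookup μ (π ⟨$⟩ˡ i)                             ≡⟨ onIndices-lookup (↭⇒↭ₛ μ↭λ) (π ⟨$⟩ˡ i) ⟩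
    lookup λs (π ⟨$⟩ʳ (π ⟨$⟩ˡ i))                   ≡⟨ cong (lookup λs) (inverseʳ π) ⟩
    lookup λs i                                     ∎
  where
  open ≡-Reasoning
  π = onIndices (↭⇒↭ₛ μ↭λ)

merge₀₁ : ∀ {m} → Fin (suc (suc m)) → Fin (suc m)
merge₀₁ zero          = zero
merge₀₁ (suc zero)    = zero
merge₀₁ (suc (suc j)) = suc j

merge₀₁≡zero : ∀ {m} (j : Fin (suc (suc m))) → merge₀₁ j ≡ zero → j ≡ zero ⊎ j ≡ suc zero
merge₀₁≡zero zero          _ = inj₁ refl
merge₀₁≡zero (suc zero)    _ = inj₂ refl
merge₀₁≡zero (suc (suc j)) ()

merge₀₁≡suc : ∀ {m} (j : Fin (suc (suc m))) {i} → merge₀₁ j ≡ suc i → j ≡ suc (suc i)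
merge₀₁≡suc (suc (suc j)) refl = refl

merge-⊑ : ∀ x y r → x ∷ y ∷ r ⊑ x + y ∷ r
merge-⊑ x y r = ⊑-via merge₀₁ (≡.sym (+-assoc x y (sum r))) merged
  where
  open ≡-Reasoning
  merged : ∀ {n} (L : ListAssignment n) cls → ClassSizes (x ∷ y ∷ r) L cls → ClassSizes (x + y ∷ r) L (merge₀₁ ∘ cls)
  merged L cls count v zero = begin
    length (filter (λ c → merge₀₁ (cls c) ≟ᶠ zero) (L v))
      ≡⟨ cong length (filter-≐ _ _ (merge₀₁≡zero (cls _) , [ cong merge₀₁ , cong merge₀₁ ]) (L v)) ⟩
    length (filter ((λ c → cls c ≟ᶠ zero) ∪? (λ c → cls c ≟ᶠ suc zero)) (L v))
      ≡⟨ length-filter-∪ _ _ (λ e e′ → 0≢1+n (trans (≡.sym e) e′)) (L v) ⟩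
    length (filter (λ c → cls c ≟ᶠ zero) (L v)) + length (filter (λ c → cls c ≟ᶠ suc zero) (L v))
      ≡⟨ cong₂ _+_ (count v zero) (count v (suc zero)) ⟩
    x + y ∎
  merged L cls count v (suc i) =
    trans (cong length (filter-≐ _ _ (merge₀₁≡suc (cls _) , cong merge₀₁) (L v))) (count v (suc (suc i)))

-- Unlike _⊑_, this stable version is a congruence for _++_ (≼-++).
record _≼_ (μ λs : List ℕ) : Set where
  constructor stably
  field extend : ∀ T → μ ++ T ⊑ λs ++ T
open _≼_

≼⇒⊑ : ∀ {μ λs} → μ ≼ λs → μ ⊑ λs
≼⇒⊑ {μ} {λs} μ≼λ = subst₂ _⊑_ (++-identityʳ μ) (++-identityʳ λs) (extend μ≼λ [])

≼-refl : ∀ {μ} → μ ≼ μ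
≼-refl = stably λ T → coarsening λ L A → A

≼-trans : ∀ {μ ν λs} → μ ≼ ν → ν ≼ λs → μ ≼ λs
≼-trans μ≼ν ν≼λ = stably λ T → ⊑-trans (extend μ≼ν T) (extend ν≼λ T)

↭⇒≼ : ∀ {μ λs} → μ ↭ λs → μ ≼ λs
↭⇒≼ μ↭λ = stably λ T → ↭⇒⊑ (++⁺ʳ T μ↭λ)

merge-≼ : ∀ x y → x ∷ y ∷ [] ≼ x + y ∷ []
merge-≼ x y = stably (merge-⊑ x y)

≼-++ : ∀ {μ λs ν ρ} → μ ≼ λs → ν ≼ ρ → μ ++ ν ≼ λs ++ ρ
≼-++ {μ} {λs} {ν} {ρ} μ≼λ ν≼ρ = stably λ T →
  ⊑-trans (↭⇒⊑ (↭-reflexive (++-assoc μ ν T))) (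
  ⊑-trans (extend μ≼λ (ν ++ T)) (
  ⊑-trans (↭⇒⊑ (shifts λs ν)) (
  ⊑-trans (extend ν≼ρ (λs ++ T))
          (↭⇒⊑ (↭-trans (shifts ρ λs) (↭-reflexive (≡.sym (++-assoc λs ρ T))))))))

ones-+ : ∀ m n → ones (m + n) ≡ ones m ++ ones n
ones-+ zero    n = refl
ones-+ (suc m) n = cong (1 ∷_) (ones-+ m n)

ones-≡1 : ∀ k → All (_≡ 1) (ones k)
ones-≡1 k = replicate⁺ k refl

sum-≡1 : ∀ {xs} → All (_≡ 1) xs → sum xs ≡ length xs
sum-≡1 []         = refl
sum-≡1 (refl ∷ p) = cong suc (sum-≡1 p)

sum-ones : ∀ k → sum (ones k) ≡ k
sum-ones k = trans (sum-≡1 (ones-≡1 k)) (length-replicate k)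

absorb-ones-≼ : ∀ j m → j ∷ ones m ≼ j + m ∷ []
absorb-ones-≼ j zero    = ↭⇒≼ (↭-reflexive (cong (_∷ []) (≡.sym (+-identityʳ j))))
absorb-ones-≼ j (suc m) =
  ≼-trans (≼-++ (merge-≼ j 1) ≼-refl) (
  ≼-trans (absorb-ones-≼ (j + 1) m)
          (↭⇒≼ (↭-reflexive (cong (_∷ []) (+-assoc j 1 m)))))

ones-sum-≼ : ∀ {r} → All (0 <_) r → ones (sum r) ≼ r
ones-sum-≼ []                           = ≼-refl
ones-sum-≼ {suc x ∷ r} (s≤s z≤n ∷ pos) =
  ≼-trans (↭⇒≼ (↭-reflexive (cong (1 ∷_) (ones-+ x (sum r)))))
          (≼-++ (absorb-ones-≼ 1 x) (ones-sum-≼ pos))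

ones⊎part≥2 : ∀ {λs} → All (0 <_) λs →
              λs ≡ ones (sum λs) ⊎ ∃₂ λ d rest → λs ↭ 2 + d ∷ rest × All (0 <_) rest
ones⊎part≥2 []                       = inj₁ refl
ones⊎part≥2 {1 ∷ λs} (_ ∷ pos) with ones⊎part≥2 pos
... | inj₁ λs≡ones              = inj₁ (cong (1 ∷_) λs≡ones)
... | inj₂ (d , rest , p , pos′) =
  inj₂ (d , 1 ∷ rest , ↭-trans (↭-prep 1 p) (↭-swap 1 (2 + d) ↭-refl) , s≤s z≤n ∷ pos′)
ones⊎part≥2 {suc (suc d) ∷ λs} (_ ∷ pos) = inj₂ (d , λs , ↭-refl , pos)

ones⊎oneTwo-≼ : ∀ k {λs} → IsPartition (2 + k) λs → λs ≡ ones (2 + k) ⊎ ones k ++ 2 ∷ [] ≼ λs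
ones⊎oneTwo-≼ k (pos , sum≡) with ones⊎part≥2 pos
... | inj₁ λs≡ones = inj₁ (trans λs≡ones (cong ones sum≡))
... | inj₂ (d , rest , p , pos′) =
  inj₂ (≼-trans (↭⇒≼ (↭-trans (++-comm (ones k) (2 ∷ [])) (↭-reflexive (cong (2 ∷_) ones-k≡))))
       (≼-trans (≼-++ (absorb-ones-≼ 2 d) (ones-sum-≼ pos′))
                (↭⇒≼ (↭-sym p))))
  where
  ones-k≡ : ones k ≡ ones d ++ ones (sum rest)
  ones-k≡ = trans (cong ones (suc-injective (suc-injective (trans (≡.sym sum≡) (sum-↭ p)))))
                  (ones-+ d (sum rest))

oneTwo-partition : ∀ k → IsPartition (2 + k) (ones k ++ 2 ∷ [])
oneTwo-partition k =
  ++⁺ (replicate⁺ k (s≤s z≤n)) (s≤s z≤n ∷ []) ,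
  trans (sum-++ (ones k) (2 ∷ [])) (trans (cong (_+ 2) (sum-ones k)) (+-comm k 2))

colorable⇒choosable : ∀ {n xs} {G : Graph n} → All (_≡ 1) xs → Colorable (length xs) G → Choosable xs G
colorable⇒choosable {G = G} xs≡1 (f , proper) L (_ , cls , count) =
  colour , proj₁ ∘ proj₂ ∘ witness , colour-proper
  where
  witness : ∀ v → ∃[ c ] c ∈ L v × cls c ≡ f v
  witness v = filter-witness (λ c → cls c ≟ᶠ f v) (L v)
                (trans (count v (f v)) (All.lookup xs≡1 (∈-lookup (f v))))
  colour = proj₁ ∘ witness
  colour-proper : ∀ u v → Adj G u v → colour u ≢ colour v
  colour-proper u v uv e =
    proper u v uv (trans (≡.sym (proj₂ (proj₂ (witness u)))) (trans (cong cls e) (proj₂ (proj₂ (witness v)))))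

toℕ-mod : ∀ {c k} .{{_ : NonZero k}} → c < k → toℕ (c mod k) ≡ c
toℕ-mod c<k = trans (toℕ-fromℕ< _) (m<n⇒m%n≡m c<k)

-- Give every vertex the palette {0, …, k-1}; under c ↦ c mod k its colour
-- classes are singletons, so it is a {1*k}-assignment.
choosable⇒colorable : ∀ {n xs} {G : Graph n} → All (_≡ 1) xs → .{{_ : NonZero (length xs)}} →
                      Choosable xs G → Colorable (length xs) G
choosable⇒colorable {xs = xs} {G} xs≡1 ch = (_mod k) ∘ c , proper
  where
  k = length xs
  palette : List Color
  palette = map toℕ (allFin k)
  palette-unique : Unique palette
  palette-unique = map⁺ toℕ-injective (allFin⁺ k)
  palette-< : ∀ {c} → c ∈ palette → c < k
  palette-< c∈ with ∈-map⁻ toℕ c∈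
  ... | j , _ , refl = toℕ<n j
  palette-length : length palette ≡ sum xs
  palette-length = trans (length-map toℕ (allFin k)) (trans (length-tabulate id) (≡.sym (sum-≡1 xs≡1)))
  palette-classes : ClassSizes xs (const palette) (_mod k)
  palette-classes v i = begin
    length (filter (λ c → c mod k ≟ᶠ i) palette)
      ≡⟨ cong length (filter-≐-∈ _ _ palette
           (λ c∈ e → trans (≡.sym (toℕ-mod (palette-< c∈))) (cong toℕ e))
           (λ c∈ e → toℕ-injective (trans (toℕ-mod (palette-< c∈)) e))) ⟩
    length (filter (_≟ toℕ i) palette) ≡⟨ length-filter-≟-unique _≟_ palette-unique (∈-map⁺ toℕ (∈-allFin i)) ⟩
    1                                  ≡⟨ ≡.sym (All.lookup xs≡1 (∈-lookup i)) ⟩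
    lookup xs i                        ∎
    where open ≡-Reasoning
  colouring : LColorable G (const palette)
  colouring = ch (const palette) ((λ _ → palette-unique , palette-length) , (_mod k) , palette-classes)
  c = proj₁ colouring
  proper : ∀ u v → Adj G u v → c u mod k ≢ c v mod k
  proper u v uv e = proj₂ (proj₂ colouring) u v uv
    (trans (≡.sym (toℕ-mod (palette-< (proj₁ (proj₂ colouring) u))))
           (trans (cong toℕ e) (toℕ-mod (palette-< (proj₁ (proj₂ colouring) v)))))

colorable⇔choosable-ones : ∀ k {n} {G : Graph n} → Colorable (suc k) G ⇔ Choosable (ones (suc k)) G
colorable⇔choosable-ones k {G = G} = mk⇔
  (λ colorable → colorable⇒choosable {G = G} (ones-≡1 (suc k)) (subst (λ m → Colorable m G) (≡.sym length-ones) colorable))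
  (λ choosable → subst (λ m → Colorable m G) length-ones (choosable⇒colorable {G = G} (ones-≡1 (suc k)) choosable))
  where
  length-ones : length (ones (suc k)) ≡ suc k
  length-ones = length-replicate (suc k)

mainTheorem5 : (k : ℕ) → 2 ≤ k → (n : ℕ) → (G : Graph n) →
    StrictlyColorable k G ⇔ (Colorable k G × ¬ Choosable (replicate (k ∸ 2) 1 ++ 2 ∷ []) G)
mainTheorem5 (suc (suc k)) (s≤s (s≤s z≤n)) n G = mk⇔ strict⇒ ⇒strict
  where
  zhu = colorable⇔choosable-ones (suc k) {G = G}
  oneTwo = ones k ++ 2 ∷ []

  2∉ones : 2 ∈ ones (2 + k) → ⊥
  2∉ones 2∈ with () ← All.lookup (ones-≡1 (2 + k)) 2∈

  strict⇒ : StrictlyColorable (2 + k) G → Colorable (2 + k) G × ¬ Choosable oneTwo G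
  strict⇒ (ones-choosable , only-ones) =
    Equivalence.from zhu ones-choosable ,
    λ oneTwo-choosable → 2∉ones (∈-resp-↭ (only-ones oneTwo (oneTwo-partition k) oneTwo-choosable)
                                          (∈-++⁺ʳ (ones k) (here refl)))

  ⇒strict : Colorable (2 + k) G × ¬ Choosable oneTwo G → StrictlyColorable (2 + k) G
  ⇒strict (colorable , ¬oneTwo-choosable) = Equivalence.to zhu colorable , only-ones
    where
    only-ones : ∀ λs → IsPartition (2 + k) λs → Choosable λs G → λs ↭ ones (2 + k)
    only-ones λs partition λs-choosable with ones⊎oneTwo-≼ k partition
    ... | inj₁ λs≡ones    = ↭-reflexive λs≡ones
    ... | inj₂ oneTwo≼λs = contradiction (choosable-⊑ {G = G} (≼⇒⊑ oneTwo≼λs) λs-choosable) ¬oneTwo-choosable
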